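{- For a positive integer $n$, let $r(n)$ denote the largest real number such that there exists a non-complete graph $G$ (i.e. a graph with $\mathrm{box}(G)>0$) on $n$ vertices with $\mathrm{cub}(G) = r(n)\,\mathrm{box}(G)$. Then there exists an interval graph $G'$ on $n$ vertices such that $\mathrm{cub}(G') = r(n)$.
   Context: All graphs are simple, finite and undirected. A graph is an interval graph if each vertex $u$ can be assigned a closed interval of the real line such that two distinct vertices are adjacent iff their intervals intersect. An axis-parallel $b$-dimensional box is a Cartesian product $R_1\times\cdots\times R_b$ where each $R_i$ is a closed interval $[a_i,b_i]$; a $b$-dimensional cube is such a product where each $R_i$ has the form $[a_i,a_i+1]$. The boxicity $\mathrm{box}(G)$ (resp. cubicity $\mathrm{cub}(G)$) is the minimum positive integer $b$ such that $G$ is the intersection graph of axis-parallel $b$-dimensional boxes (resp. cubes), one per vertex, with distinct vertices adjacent iff their boxes (cubes) intersect. The boxicity and cubicity of a complete graph are defined to be $0$.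
   Formalization: The intervals, boxes and cubes defining interval graphs, boxicity and cubicity have rational endpoints and coordinates rather than real ones. -}

module Defs where

open import Data.Nat using (ℕ; zero; suc; _≤_; _*_)
open import Data.Fin using (Fin)
open import Data.Bool using (Bool; true; false)
open import Data.Rational using (ℚ; _+_; 1ℚ) renaming (_≤_ to _≤ℚ_)
open import Data.Product using (Σ; _×_; ∃; ∃-syntax)
open import Data.Sum using (_⊎_)
open import Relation.Nullary using (¬_)
open import Relation.Binary.PropositionalEquality using (_≡_; _≢_)
open import Function.Bundles using (_⇔_)

record Graph (n : ℕ) : Set where
  field
    adj     : Fin n → Fin n → Bool
    adj-sym : ∀ u v → adj u v ≡ adj v u
    irrefl  : ∀ u → adj u u ≡ false
open Graph public

Adjacent : ∀ {n} → Graph n → Fin n → Fin n → Set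
Adjacent G u v = adj G u v ≡ true

IsComplete : ∀ {n} → Graph n → Set
IsComplete {n} G = ∀ (u v : Fin n) → u ≢ v → Adjacent G u v

IntervalsMeet : ℚ → ℚ → ℚ → ℚ → Set
IntervalsMeet a₁ b₁ a₂ b₂ = (a₁ ≤ℚ b₂) × (a₂ ≤ℚ b₁)

IsIntervalGraph : ∀ {n} → Graph n → Set
IsIntervalGraph {n} G =
  Σ (Fin n → ℚ) λ lo → Σ (Fin n → ℚ) λ hi →
    (∀ u → lo u ≤ℚ hi u) ×
    (∀ u v → u ≢ v → (Adjacent G u v ⇔ IntervalsMeet (lo u) (hi u) (lo v) (hi v)))

HasBoxRep : ∀ {n} → Graph n → ℕ → Set
HasBoxRep {n} G b =
  Σ (Fin n → Fin b → ℚ) λ lo → Σ (Fin n → Fin b → ℚ) λ hi →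
    (∀ u k → lo u k ≤ℚ hi u k) ×
    (∀ u v → u ≢ v →
      (Adjacent G u v ⇔ (∀ k → IntervalsMeet (lo u k) (hi u k) (lo v k) (hi v k))))

HasCubeRep : ∀ {n} → Graph n → ℕ → Set
HasCubeRep {n} G b =
  Σ (Fin n → Fin b → ℚ) λ a →
    ∀ u v → u ≢ v →
      (Adjacent G u v ⇔ (∀ k → IntervalsMeet (a u k) (a u k + 1ℚ) (a v k) (a v k + 1ℚ)))

IsBoxicity : ∀ {n} → Graph n → ℕ → Set
IsBoxicity G b =
  (IsComplete G × b ≡ 0) ⊎
  (¬ IsComplete G × 1 ≤ b × HasBoxRep G b × (∀ b' → 1 ≤ b' → HasBoxRep G b' → b ≤ b'))

IsCubicity : ∀ {n} → Graph n → ℕ → Set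
IsCubicity G c =
  (IsComplete G × c ≡ 0) ⊎
  (¬ IsComplete G × 1 ≤ c × HasCubeRep G c × (∀ c' → 1 ≤ c' → HasCubeRep G c' → c ≤ c'))

-- r n = r : r is the largest value of cub(G)/box(G) over non-complete graphs G on n
-- vertices (ratio compared by cross-multiplication; box(G) ≥ 1 for such G).
IsMaxCubBoxRatio : ℕ → ℕ → Set
IsMaxCubBoxRatio n r =
  (∀ (G : Graph n) b c → ¬ IsComplete G → IsBoxicity G b → IsCubicity G c → c ≤ r * b) ×
  (Σ (Graph n) λ G → ∃[ b ] ∃[ c ] (¬ IsComplete G × IsBoxicity G b × IsCubicity G c × c ≡ r * b))

{-
Let c be the least d such that every interval graph on n vertices has a
d-dimensional unit-cube representation. Since n ≥ 2 there is a non-complete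
interval graph, so c ≥ 1; and c ≤ n, since coordinate w may place w at 0, its
neighbours at 1 and all other vertices at 2. A graph of boxicity b is the
intersection of b interval graphs, and stacking c-dimensional cube
representations of these gives one of G in dimension c·b, so cub(G) ≤ c·box(G).
An interval graph of cubicity exactly c has boxicity 1, hence c is the maximal
ratio.

Constructively, c and such an interval graph are found by exhaustive search,
which needs two finiteness results. Interval endpoints may be replaced by their
ranks among all 2n endpoints. Rationals x_u may be replaced by naturals below
(2n+1)(n+1) with the same relations x_u ≤ x_v + 1: shifting so that
x_u + s = m_u + f_u with m_u ∈ ℕ and 0 ≤ f_u < 1, these relations only depend on
the order and the successor relation among the m_u and on the order of the f_u,
and both survive shrinking the gaps of length ≥ 2 between the m_u and ranking
the f_u.
-}
module Submission where

open import Defs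
open import Data.Bool using (true)
open import Data.Nat as ℕ using (ℕ; zero; suc; _+_; _*_; _∸_; _≤_; _<_; _≤?_; _<?_; _≟_; z≤n; s≤s)
import Data.Nat.Properties as ℕ
open import Data.Nat.DivMod using (_/_; _%_; m≡m%n+[m/n]*n; m%n<n)
import Data.Nat.Tactic.RingSolver as ℕ-Solver
open import Data.Integer as ℤ using (ℤ; +_; -[1+_]; ∣_∣; +≤+)
import Data.Integer.Properties as ℤ
import Data.Integer.Tactic.RingSolver as ℤ-Solver
open import Data.Rational as ℚ using (ℚ; mkℚ; 1ℚ; toℚᵘ; fromℚᵘ)
import Data.Rational.Properties as ℚ
open import Data.Rational.Unnormalised as ℚᵘ using (ℚᵘ; mkℚᵘ; 1ℚᵘ; *≤*)
import Data.Rational.Unnormalised.Properties as ℚᵘ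
open import Data.Fin using (Fin; toℕ; fromℕ<; splitAt; _↑ˡ_; _↑ʳ_; combine; remQuot)
  renaming (zero to 0F; suc to sucF; _≟_ to _≟ᶠ_)
open import Data.Fin.Properties using (any?; all?; toℕ-fromℕ<; splitAt-↑ˡ; splitAt-↑ʳ; remQuot-combine)
open import Data.Vec using (Vec; []; _∷_; lookup; tabulate)
open import Data.Vec.Properties using (lookup∘tabulate)
open import Data.Product using (Σ; ∃; ∃-syntax; _×_; _,_; proj₁; proj₂; swap)
open import Data.Product.Function.NonDependent.Propositional using (_×-⇔_)
open import Data.Sum using (_⊎_; inj₁; inj₂; [_,_]; [_,_]′)
open import Data.Sum.Function.Propositional using (_⊎-⇔_)
open import Data.Empty using (⊥-elim)
open import Function using (_∘_; id; const)
open import Function.Bundles using (_⇔_; mk⇔; Equivalence)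
open import Function.Properties.Equivalence using () renaming (sym to ⇔-sym; trans to ⇔-trans)
open import Function.Related.Propositional using (module EquationalReasoning)
open import Relation.Nullary using (¬_; Dec; yes; no; does; ¬?)
open import Relation.Nullary.Decidable
  using (map; map′; _×-dec_; _⊎-dec_; _→-dec_; decidable-stable; dec-false; does-⇔)
open import Relation.Binary.PropositionalEquality
  using (_≡_; _≢_; refl; sym; trans; cong; cong₂; subst; subst₂; module ≡-Reasoning)
open import Algebra.Properties.CommutativeMonoid.Sum ℕ.+-0-commutativeMonoid using (sum-syntax)

∀-⇔ : ∀ {a p q} {A : Set a} {P : A → Set p} {Q : A → Set q} →
      (∀ x → P x ⇔ Q x) → (∀ x → P x) ⇔ (∀ x → Q x)
∀-⇔ P⇔Q = mk⇔ (λ f x → Equivalence.to (P⇔Q x) (f x)) (λ g x → Equivalence.from (P⇔Q x) (g x))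

_⇔-dec_ : ∀ {a b} {A : Set a} {B : Set b} → Dec A → Dec B → Dec (A ⇔ B)
a? ⇔-dec b? = map′ (λ (f , g) → mk⇔ f g) (λ e → Equivalence.to e , Equivalence.from e)
                   ((a? →-dec b?) ×-dec (b? →-dec a?))

does≡true⇔ : ∀ {a} {A : Set a} (a? : Dec A) → does a? ≡ true ⇔ A
does≡true⇔ (yes a) = mk⇔ (λ _ → a) (λ _ → refl)
does≡true⇔ (no ¬a) = mk⇔ (λ ()) (⊥-elim ∘ ¬a)

-- Counting and ranks

indicator : ∀ {a} {A : Set a} → Dec A → ℕ
indicator (yes _) = 1
indicator (no _)  = 0

indicator≤1 : ∀ {a} {A : Set a} (a? : Dec A) → indicator a? ≤ 1
indicator≤1 (yes _) = s≤s z≤n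
indicator≤1 (no _)  = z≤n

indicator-mono : ∀ {a b} {A : Set a} {B : Set b} → (A → B) →
                 (a? : Dec A) (b? : Dec B) → indicator a? ≤ indicator b?
indicator-mono A⇒B (yes _) (yes _) = s≤s z≤n
indicator-mono A⇒B (yes a) (no ¬b) = ⊥-elim (¬b (A⇒B a))
indicator-mono A⇒B (no _)  _       = z≤n

indicator-< : ∀ {a b} {A : Set a} {B : Set b} → ¬ A → B →
              (a? : Dec A) (b? : Dec B) → indicator a? < indicator b?
indicator-< ¬a b (yes a) _      = ⊥-elim (¬a a)
indicator-< ¬a b (no _) (yes _) = s≤s z≤n
indicator-< ¬a b (no _) (no ¬b) = ⊥-elim (¬b b)

∑-mono-≤ : ∀ {n} {f g : Fin n → ℕ} → (∀ i → f i ≤ g i) →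
           ∑[ i < n ] f i ≤ ∑[ i < n ] g i
∑-mono-≤ {zero}  f≤g = z≤n
∑-mono-≤ {suc n} f≤g = ℕ.+-mono-≤ (f≤g 0F) (∑-mono-≤ (f≤g ∘ sucF))

∑-mono-< : ∀ {n} {f g : Fin n → ℕ} → (∀ i → f i ≤ g i) → ∀ j → f j < g j →
           ∑[ i < n ] f i < ∑[ i < n ] g i
∑-mono-< {suc n} f≤g 0F       f<g = ℕ.+-mono-<-≤ f<g (∑-mono-≤ (f≤g ∘ sucF))
∑-mono-< {suc n} f≤g (sucF j) f<g = ℕ.+-mono-≤-< (f≤g 0F) (∑-mono-< (f≤g ∘ sucF) j f<g)

∑-bounded : ∀ {n c} {f : Fin n → ℕ} → (∀ i → f i ≤ c) → ∑[ i < n ] f i ≤ n * c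
∑-bounded {zero}  f≤c = z≤n
∑-bounded {suc n} f≤c = ℕ.+-mono-≤ (f≤c 0F) (∑-bounded (f≤c ∘ sucF))

term≤∑ : ∀ {n} (f : Fin n → ℕ) j → f j ≤ ∑[ i < n ] f i
term≤∑ f 0F       = ℕ.m≤m+n _ _
term≤∑ f (sucF j) = ℕ.≤-trans (term≤∑ (f ∘ sucF) j) (ℕ.m≤n+m _ _)

module Rank {a ℓ} {A : Set a} {_≼_ : A → A → Set ℓ}
            (_≼?_ : ∀ x y → Dec (x ≼ y))
            (≼-trans : ∀ {x y z} → x ≼ y → y ≼ z → x ≼ z)
            (≼-total : ∀ x y → x ≼ y ⊎ y ≼ x)
            {N : ℕ} (p : Fin N → A) where

  below : A → Fin N → ℕ
  below z i = indicator (¬? (z ≼? p i))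

  rank : A → ℕ
  rank z = ∑[ i < N ] below z i

  ≼-refl : ∀ x → x ≼ x
  ≼-refl x = [ id , id ] (≼-total x x)

  below-mono : ∀ {z z'} → z ≼ z' → ∀ i → below z i ≤ below z' i
  below-mono z≼z' i =
    indicator-mono (λ z⋠pᵢ z'≼pᵢ → z⋠pᵢ (≼-trans z≼z' z'≼pᵢ)) (¬? (_ ≼? p i)) (¬? (_ ≼? p i))

  rank-mono : ∀ {z z'} → z ≼ z' → rank z ≤ rank z'
  rank-mono = ∑-mono-≤ ∘ below-mono

  rank≤N : ∀ z → rank z ≤ N
  rank≤N z = subst (rank z ≤_) (ℕ.*-identityʳ N) (∑-bounded λ i → indicator≤1 (¬? (z ≼? p i)))

  rank-< : ∀ {z} i → ¬ z ≼ p i → rank (p i) < rank z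
  rank-< {z} i z⋠pᵢ = ∑-mono-< (below-mono pᵢ≼z) i
    (indicator-< (λ pᵢ⋠pᵢ → pᵢ⋠pᵢ (≼-refl (p i))) z⋠pᵢ (¬? (p i ≼? p i)) (¬? (z ≼? p i)))
    where
    pᵢ≼z : p i ≼ z
    pᵢ≼z = [ id , (λ z≼pᵢ → ⊥-elim (z⋠pᵢ z≼pᵢ)) ] (≼-total (p i) z)

  ≼⇔rank-≤ : ∀ z i → z ≼ p i ⇔ rank z ≤ rank (p i)
  ≼⇔rank-≤ z i = mk⇔ rank-mono from
    where
    from : rank z ≤ rank (p i) → z ≼ p i
    from rz≤rpᵢ with z ≼? p i
    ... | yes z≼pᵢ = z≼pᵢ
    ... | no  z⋠pᵢ = ⊥-elim (ℕ.<⇒≱ (rank-< i z⋠pᵢ) rz≤rpᵢ)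

-- Squashing the integer parts

-- charge c t = |{c, c + 1} ∩ [0, t]| grows at t exactly when c ∈ {t, t + 1}, which pays
-- for t being occupied; this double counting bounds squash by 2n.
charge : ℕ → ℕ → ℕ
charge c t = indicator (c <? t) + indicator (c <? suc t)

charge≤2 : ∀ c t → charge c t ≤ 2
charge≤2 c t = ℕ.+-mono-≤ (indicator≤1 (c <? t)) (indicator≤1 (c <? suc t))

charge-mono : ∀ c t → charge c t ≤ charge c (suc t)
charge-mono c t = ℕ.+-mono-≤ (step t) (step (suc t))
  where
  step : ∀ s → indicator (c <? s) ≤ indicator (c <? suc s)
  step s = indicator-mono ℕ.m<n⇒m<1+n (c <? s) (c <? suc s)

charge-< : ∀ {c t} → c ≡ t ⊎ c ≡ suc t → charge c t < charge c (suc t)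
charge-< {t = t} (inj₁ refl) = ℕ.+-mono-<-≤
  (indicator-< (ℕ.<-irrefl refl) ℕ.≤-refl (t <? t) (t <? suc t))
  (indicator-mono ℕ.m<n⇒m<1+n (t <? suc t) (t <? suc (suc t)))
charge-< {t = t} (inj₂ refl) = ℕ.+-mono-≤-<
  (indicator-mono ℕ.m<n⇒m<1+n (suc t <? t) (suc t <? suc t))
  (indicator-< (ℕ.<-irrefl refl) ℕ.≤-refl (suc t <? suc t) (suc t <? suc (suc t)))

module Squash {n : ℕ} (m : Fin n → ℕ) where

  Occupied : ℕ → Set
  Occupied t = ∃[ w ] (m w ≡ t ⊎ m w ≡ suc t)

  occupied? : ∀ t → Dec (Occupied t)
  occupied? t = any? λ w → (m w ≟ t) ⊎-dec (m w ≟ suc t)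

  squash : ℕ → ℕ
  squash zero    = 0
  squash (suc t) = squash t + indicator (occupied? t)

  squash-mono : ∀ {t t'} → t ≤ t' → squash t ≤ squash t'
  squash-mono {t' = zero}   z≤n  = z≤n
  squash-mono {t} {suc t'} t≤1+t' with ℕ.m≤n⇒m<n∨m≡n t≤1+t'
  ... | inj₁ t<1+t' = ℕ.≤-trans (squash-mono (ℕ.s≤s⁻¹ t<1+t')) (ℕ.m≤m+n _ _)
  ... | inj₂ refl   = ℕ.≤-refl

  squash-occupied : ∀ {t} → Occupied t → squash (suc t) ≡ suc (squash t)
  squash-occupied {t} occ with occupied? t
  ... | yes _   = ℕ.+-comm (squash t) 1
  ... | no ¬occ = ⊥-elim (¬occ occ)

  squash-< : ∀ {t t'} → Occupied t → t < t' → squash t < squash t'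
  squash-< {t' = t'} occ t<t' = subst (_≤ squash t') (squash-occupied occ) (squash-mono t<t')

  ≤⇔squash-≤ : ∀ u v → m u ≤ m v ⇔ squash (m u) ≤ squash (m v)
  ≤⇔squash-≤ u v = mk⇔ squash-mono from
    where
    from : squash (m u) ≤ squash (m v) → m u ≤ m v
    from squash≤ with m u ℕ.≤? m v
    ... | yes mu≤mv = mu≤mv
    ... | no  mu≰mv = ⊥-elim (ℕ.<⇒≱ (squash-< (v , inj₁ refl) (ℕ.≰⇒> mu≰mv)) squash≤)

  ≡suc⇔squash-≡suc : ∀ u v → m u ≡ suc (m v) ⇔ squash (m u) ≡ suc (squash (m v))
  ≡suc⇔squash-≡suc u v = mk⇔ to from
    where
    to : m u ≡ suc (m v) → squash (m u) ≡ suc (squash (m v))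
    to mu≡1+mv = trans (cong squash mu≡1+mv) (squash-occupied (v , inj₁ refl))
    from : squash (m u) ≡ suc (squash (m v)) → m u ≡ suc (m v)
    from eq with m u ℕ.≤? m v
    ... | yes mu≤mv = ⊥-elim (ℕ.<⇒≱ (ℕ.≤-reflexive (sym eq)) (squash-mono mu≤mv))
    ... | no  mu≰mv with m u in mu≡
    ...   | zero  = ⊥-elim (mu≰mv z≤n)
    ...   | suc k with ℕ.m≤n⇒m<n∨m≡n (ℕ.s≤s⁻¹ (ℕ.≰⇒> mu≰mv))
    ...     | inj₂ mv≡k = cong suc (sym mv≡k)
    ...     | inj₁ mv<k = ⊥-elim (ℕ.<-irrefl (sym eq) (begin-strict
      suc (squash (m v)) <⟨ s≤s (squash-< (v , inj₁ refl) mv<k) ⟩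
      suc (squash k)     ≡⟨ squash-occupied (u , inj₂ mu≡) ⟨
      squash (suc k)     ∎))
      where open ℕ.≤-Reasoning

  squash≤∑charge : ∀ t → squash t ≤ ∑[ w < n ] charge (m w) t
  squash≤∑charge zero    = z≤n
  squash≤∑charge (suc t) with occupied? t
  ... | yes (w , mw≈t) = ℕ.≤-trans (ℕ.≤-reflexive (ℕ.+-comm (squash t) 1))
    (ℕ.≤-trans (s≤s (squash≤∑charge t)) (∑-mono-< (λ w → charge-mono (m w) t) w (charge-< mw≈t)))
  ... | no _           = ℕ.≤-trans (ℕ.≤-reflexive (ℕ.+-identityʳ (squash t)))
    (ℕ.≤-trans (squash≤∑charge t) (∑-mono-≤ (λ w → charge-mono (m w) t)))

  squash≤2n : ∀ t → squash t ≤ n * 2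
  squash≤2n t = ℕ.≤-trans (squash≤∑charge t) (∑-bounded λ w → charge≤2 (m w) t)

-- Unit intervals with rational and with natural endpoints

radix-≤⇔ : ∀ {X} mu mv {a b} → a < X → b < X →
           mu * X + a ≤ mv * X + b + X ⇔ (mu ≤ mv ⊎ (mu ≡ suc mv × a ≤ b))
radix-≤⇔ {X} mu mv {a} {b} a<X b<X = mk⇔ to from
  where
  open ℕ.≤-Reasoning

  carry-l : ∀ m X a → suc m * X + a ≡ (m * X + X) + a
  carry-l = ℕ-Solver.solve-∀
  carry-r : ∀ m X b → m * X + b + X ≡ (m * X + X) + b
  carry-r = ℕ-Solver.solve-∀

  to : mu * X + a ≤ mv * X + b + X → mu ≤ mv ⊎ (mu ≡ suc mv × a ≤ b)
  to lhs≤rhs with mu ≤? mv | mu ≟ suc mv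
  ... | yes mu≤mv | _        = inj₁ mu≤mv
  ... | no  _     | yes refl = inj₂ (refl , ℕ.+-cancelˡ-≤ (mv * X + X) a b
                                      (subst₂ _≤_ (carry-l mv X a) (carry-r mv X b) lhs≤rhs))
  ... | no  mu≰mv | no mu≢1+mv = ⊥-elim (ℕ.<⇒≱ (begin-strict
        mv * X + b + X     <⟨ ℕ.+-monoˡ-< X (ℕ.+-monoʳ-< (mv * X) b<X) ⟩
        mv * X + X + X     ≡⟨ carry-l mv X X ⟨
        suc mv * X + X     ≡⟨ ℕ.+-comm (suc mv * X) X ⟩
        suc (suc mv) * X   ≤⟨ ℕ.*-monoˡ-≤ X 2+mv≤mu ⟩
        mu * X             ≤⟨ ℕ.m≤m+n (mu * X) a ⟩
        mu * X + a         ∎) lhs≤rhs)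
    where
    2+mv≤mu : suc (suc mv) ≤ mu
    2+mv≤mu = ℕ.≤∧≢⇒< (ℕ.≰⇒> mu≰mv) (λ eq → mu≢1+mv (sym eq))

  from : mu ≤ mv ⊎ (mu ≡ suc mv × a ≤ b) → mu * X + a ≤ mv * X + b + X
  from (inj₁ mu≤mv) = begin
    mu * X + a      ≤⟨ ℕ.+-monoʳ-≤ (mu * X) (ℕ.<⇒≤ a<X) ⟩
    mu * X + X      ≤⟨ ℕ.+-monoˡ-≤ X (ℕ.*-monoˡ-≤ X mu≤mv) ⟩
    mv * X + X      ≤⟨ ℕ.+-monoˡ-≤ X (ℕ.m≤m+n (mv * X) b) ⟩
    mv * X + b + X  ∎
  from (inj₂ (refl , a≤b)) =
    subst₂ _≤_ (sym (carry-l mv X a)) (sym (carry-r mv X b)) (ℕ.+-monoʳ-≤ (mv * X + X) a≤b)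

≤ᵘ-resp-≃ : ∀ {p p' q q'} → p ℚᵘ.≃ p' → q ℚᵘ.≃ q' → p ℚᵘ.≤ q ⇔ p' ℚᵘ.≤ q'
≤ᵘ-resp-≃ p≃p' q≃q' = mk⇔
  (λ p≤q → ℚᵘ.≤-respˡ-≃ p≃p' (ℚᵘ.≤-respʳ-≃ q≃q' p≤q))
  (λ p'≤q' → ℚᵘ.≤-respˡ-≃ (ℚᵘ.≃-sym p≃p') (ℚᵘ.≤-respʳ-≃ (ℚᵘ.≃-sym q≃q') p'≤q'))

≤ᵘ+1⇔ : ∀ p q →
        p ℚᵘ.≤ q ℚᵘ.+ 1ℚᵘ ⇔ ℚᵘ.↥ p ℤ.* ℚᵘ.↧ q ℤ.≤ (ℚᵘ.↥ q ℤ.+ ℚᵘ.↧ q) ℤ.* ℚᵘ.↧ p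
≤ᵘ+1⇔ (mkℚᵘ a b) (mkℚᵘ c e) = mk⇔ (λ { (*≤* h) → subst₂ ℤ._≤_ lhs rhs h })
                                  (λ h → *≤* (subst₂ ℤ._≤_ (sym lhs) (sym rhs) h))
  where
  lhs : a ℤ.* + suc (e ℕ.* 1) ≡ a ℤ.* + suc e
  lhs = cong (λ k → a ℤ.* + suc k) (ℕ.*-identityʳ e)
  rhs : (c ℤ.* + 1 ℤ.+ + 1 ℤ.* + suc e) ℤ.* + suc b ≡ (c ℤ.+ + suc e) ℤ.* + suc b
  rhs = cong (ℤ._* + suc b) (cong₂ ℤ._+_ (ℤ.*-identityʳ c) (ℤ.*-identityˡ (+ suc e)))

≤+1⇔≤ᵘ+1 : ∀ x y → x ℚ.≤ y ℚ.+ 1ℚ ⇔ toℚᵘ x ℚᵘ.≤ toℚᵘ y ℚᵘ.+ 1ℚᵘ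
≤+1⇔≤ᵘ+1 x y = mk⇔
  (λ x≤y+1 → ℚᵘ.≤-respʳ-≃ (ℚ.toℚᵘ-homo-+ y 1ℚ) (ℚ.toℚᵘ-mono-≤ x≤y+1))
  (λ x≤y+1 → ℚ.toℚᵘ-cancel-≤ (ℚᵘ.≤-respʳ-≃ (ℚᵘ.≃-sym (ℚ.toℚᵘ-homo-+ y 1ℚ)) x≤y+1))

≤+1⇔ : ∀ x y → x ℚ.≤ y ℚ.+ 1ℚ ⇔ ℚ.↥ x ℤ.* ℚ.↧ y ℤ.≤ (ℚ.↥ y ℤ.+ ℚ.↧ y) ℤ.* ℚ.↧ x
≤+1⇔ x@(mkℚ _ _ _) y@(mkℚ _ _ _) = ⇔-trans (≤+1⇔≤ᵘ+1 x y) (≤ᵘ+1⇔ (toℚᵘ x) (toℚᵘ y))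

-- gridPoint t p = p / (t + 1): the second argument of mkℚᵘ is the denominator minus one.
gridPoint : ℕ → ℕ → ℚ
gridPoint t p = fromℚᵘ (mkℚᵘ (+ p) t)

*suc-≤⇔ : ∀ a b t → + a ℤ.* + suc t ℤ.≤ + b ℤ.* + suc t ⇔ a ℕ.≤ b
*suc-≤⇔ a b t = mk⇔ (λ h → ℤ.drop‿+≤+ (ℤ.*-cancelʳ-≤-pos (+ a) (+ b) (+ suc t) h))
                    (λ a≤b → ℤ.*-monoʳ-≤-nonNeg (+ suc t) (+≤+ a≤b))

gridPoint-≤⇔ : ∀ t p q → gridPoint t p ℚ.≤ gridPoint t q ⇔ p ℕ.≤ q
gridPoint-≤⇔ t p q = begin
  gridPoint t p ℚ.≤ gridPoint t q
    ∼⟨ mk⇔ ℚ.toℚᵘ-mono-≤ ℚ.toℚᵘ-cancel-≤ ⟩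
  toℚᵘ (gridPoint t p) ℚᵘ.≤ toℚᵘ (gridPoint t q)
    ∼⟨ ≤ᵘ-resp-≃ (ℚ.toℚᵘ-fromℚᵘ _) (ℚ.toℚᵘ-fromℚᵘ _) ⟩
  mkℚᵘ (+ p) t ℚᵘ.≤ mkℚᵘ (+ q) t
    ∼⟨ mk⇔ (λ { (*≤* h) → h }) *≤* ⟩
  + p ℤ.* + suc t ℤ.≤ + q ℤ.* + suc t
    ∼⟨ *suc-≤⇔ p q t ⟩
  p ℕ.≤ q ∎
  where open EquationalReasoning

gridPoint-≤+1⇔ : ∀ t p q → gridPoint t p ℚ.≤ gridPoint t q ℚ.+ 1ℚ ⇔ p ℕ.≤ q ℕ.+ suc t
gridPoint-≤+1⇔ t p q = begin
  gridPoint t p ℚ.≤ gridPoint t q ℚ.+ 1ℚ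
    ∼⟨ ≤+1⇔≤ᵘ+1 (gridPoint t p) (gridPoint t q) ⟩
  toℚᵘ (gridPoint t p) ℚᵘ.≤ toℚᵘ (gridPoint t q) ℚᵘ.+ 1ℚᵘ
    ∼⟨ ≤ᵘ-resp-≃ (ℚ.toℚᵘ-fromℚᵘ (mkℚᵘ (+ p) t))
                 (ℚᵘ.+-congˡ 1ℚᵘ (ℚ.toℚᵘ-fromℚᵘ (mkℚᵘ (+ q) t))) ⟩
  mkℚᵘ (+ p) t ℚᵘ.≤ mkℚᵘ (+ q) t ℚᵘ.+ 1ℚᵘ
    ∼⟨ ≤ᵘ+1⇔ (mkℚᵘ (+ p) t) (mkℚᵘ (+ q) t) ⟩
  + p ℤ.* + suc t ℤ.≤ (+ q ℤ.+ + suc t) ℤ.* + suc t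
    ≡⟨ cong (λ i → + p ℤ.* + suc t ℤ.≤ i ℤ.* + suc t) (ℤ.pos-+ q (suc t)) ⟨
  + p ℤ.* + suc t ℤ.≤ + (q ℕ.+ suc t) ℤ.* + suc t
    ∼⟨ *suc-≤⇔ p (q ℕ.+ suc t) t ⟩
  p ℕ.≤ q ℕ.+ suc t ∎
  where open EquationalReasoning

offset : ℤ → ℕ → ℕ
offset (+ a)    k = a + k
offset -[1+ a ] k = k ∸ suc a

offset-correct : ∀ i k → ∣ i ∣ ≤ k → + offset i k ≡ i ℤ.+ + k
offset-correct (+ a)    k _     = ℤ.pos-+ a k
offset-correct -[1+ a ] k a<k = sym (ℤ.⊖-≥ a<k)

+-monoˡ-≤⇔ : ∀ k {i j} → i ℤ.≤ j ⇔ i ℤ.+ k ℤ.≤ j ℤ.+ k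
+-monoˡ-≤⇔ k {i} {j} = mk⇔ (ℤ.+-monoˡ-≤ k)
  (λ h → subst₂ ℤ._≤_ (cancel i k) (cancel j k) (ℤ.+-monoˡ-≤ (ℤ.- k) h))
  where
  cancel : ∀ a c → a ℤ.+ c ℤ.- c ≡ a
  cancel = ℤ-Solver.solve-∀

shifted-* : ∀ {p : ℤ} {P} s d e → + P ≡ p ℤ.+ + (s * d) →
            + (P * e) ≡ p ℤ.* + e ℤ.+ + s ℤ.* + d ℤ.* + e
shifted-* {p} {P} s d e P≡ = begin
  + (P * e)                         ≡⟨ ℤ.pos-* P e ⟩
  + P ℤ.* + e                       ≡⟨ cong (ℤ._* + e) P≡ ⟩
  (p ℤ.+ + (s * d)) ℤ.* + e         ≡⟨ cong (λ i → (p ℤ.+ i) ℤ.* + e) (ℤ.pos-* s d) ⟩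
  (p ℤ.+ + s ℤ.* + d) ℤ.* + e       ≡⟨ distrib p (+ s ℤ.* + d) (+ e) ⟩
  p ℤ.* + e ℤ.+ + s ℤ.* + d ℤ.* + e ∎
  where
  open ≡-Reasoning
  distrib : ∀ a b c → (a ℤ.+ b) ℤ.* c ≡ a ℤ.* c ℤ.+ b ℤ.* c
  distrib = ℤ-Solver.solve-∀

cross-≤+1-shift⇔ : ∀ (p q : ℤ) (dp dq s P Q : ℕ) →
  + P ≡ p ℤ.+ + (s * dp) → + Q ≡ q ℤ.+ + (s * dq) →
  p ℤ.* + dq ℤ.≤ (q ℤ.+ + dq) ℤ.* + dp ⇔ P * dq ≤ Q * dp + dp * dq
cross-≤+1-shift⇔ p q dp dq s P Q P≡ Q≡ = begin
  p ℤ.* + dq ℤ.≤ (q ℤ.+ + dq) ℤ.* + dp                      ∼⟨ +-monoˡ-≤⇔ K ⟩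
  p ℤ.* + dq ℤ.+ K ℤ.≤ (q ℤ.+ + dq) ℤ.* + dp ℤ.+ K          ≡⟨ cong₂ ℤ._≤_ (sym lhs) (sym rhs) ⟩
  + (P * dq) ℤ.≤ + (Q * dp + dp * dq)                       ∼⟨ mk⇔ ℤ.drop‿+≤+ +≤+ ⟩
  P * dq ≤ Q * dp + dp * dq                                 ∎
  where
  open EquationalReasoning
  K = + s ℤ.* + dp ℤ.* + dq
  lhs : + (P * dq) ≡ p ℤ.* + dq ℤ.+ K
  lhs = shifted-* {p} s dp dq P≡
  rearrange : ∀ a b c d → a ℤ.* b ℤ.+ c ℤ.* d ℤ.* b ℤ.+ b ℤ.* d ≡ (a ℤ.+ d) ℤ.* b ℤ.+ c ℤ.* b ℤ.* d
  rearrange = ℤ-Solver.solve-∀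
  rhs : + (Q * dp + dp * dq) ≡ (q ℤ.+ + dq) ℤ.* + dp ℤ.+ K
  rhs = trans (ℤ.pos-+ (Q * dp) (dp * dq))
              (trans (cong₂ ℤ._+_ (shifted-* {q} s dq dp Q≡) (ℤ.pos-* dp dq)) (rearrange q (+ dp) (+ s) (+ dq)))

-- x u + shift = whole u + part u / den u with whole u ∈ ℕ and 0 ≤ part u < den u.
module GridNormalForm {n : ℕ} (x : Fin n → ℚ) where

  num : Fin n → ℤ
  num u = ℚ.↥ x u

  den : Fin n → ℕ
  den u = ℚ.↧ₙ x u

  shift : ℕ
  shift = ∑[ w < n ] ∣ num w ∣

  shifted : Fin n → ℕ
  shifted u = offset (num u) (shift * den u)

  shifted-correct : ∀ u → + shifted u ≡ num u ℤ.+ + (shift * den u)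
  shifted-correct u = offset-correct (num u) (shift * den u)
    (ℕ.≤-trans (term≤∑ (λ w → ∣ num w ∣) u) (ℕ.m≤m*n shift (den u)))

  whole part : Fin n → ℕ
  whole u = shifted u / den u
  part  u = shifted u % den u

  part<den : ∀ u → part u < den u
  part<den u = m%n<n (shifted u) (den u)

  frac : Fin n → ℚᵘ
  frac u = mkℚᵘ (+ part u) (ℕ.pred (den u))

  frac-≤⇔ : ∀ u v → frac u ℚᵘ.≤ frac v ⇔ part u * den v ≤ part v * den u
  frac-≤⇔ u v = mk⇔ (λ { (*≤* h) → ℤ.drop‿+≤+ (subst₂ ℤ._≤_ (sym lhs) (sym rhs) h) })
                    (λ h → *≤* (subst₂ ℤ._≤_ lhs rhs (+≤+ h)))
    where
    lhs = ℤ.pos-* (part u) (den v)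
    rhs = ℤ.pos-* (part v) (den u)

  open Rank ℚᵘ._≤?_ ℚᵘ.≤-trans ℚᵘ.≤-total frac

  open Squash whole

  T : ℕ
  T = suc n

  grid : Fin n → ℕ
  grid u = squash (whole u) * T + rank (frac u)

  rank<T : ∀ u → rank (frac u) < T
  rank<T u = s≤s (rank≤N (frac u))

  grid<bound : ∀ u → grid u < suc (n * 2) * T
  grid<bound u = begin-strict
    squash (whole u) * T + rank (frac u) <⟨ ℕ.+-monoʳ-< (squash (whole u) * T) (rank<T u) ⟩
    squash (whole u) * T + T             ≤⟨ ℕ.+-monoˡ-≤ T (ℕ.*-monoˡ-≤ T (squash≤2n (whole u))) ⟩
    n * 2 * T + T                        ≡⟨ ℕ.+-comm (n * 2 * T) T ⟩
    suc (n * 2) * T                      ∎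
    where open ℕ.≤-Reasoning

  expand : ∀ u e → shifted u * e ≡ whole u * (den u * e) + part u * e
  expand u e = trans (cong (_* e) (m≡m%n+[m/n]*n (shifted u) (den u))) (regroup (part u) (whole u) (den u) e)
    where
    regroup : ∀ r m d e → (r + m * d) * e ≡ m * (d * e) + r * e
    regroup = ℕ-Solver.solve-∀

  ≤+1⇔grid-≤ : ∀ u v → x u ℚ.≤ x v ℚ.+ 1ℚ ⇔ grid u ≤ grid v + T
  ≤+1⇔grid-≤ u v = begin
    x u ℚ.≤ x v ℚ.+ 1ℚ
      ∼⟨ ≤+1⇔ (x u) (x v) ⟩
    num u ℤ.* + den v ℤ.≤ (num v ℤ.+ + den v) ℤ.* + den u
      ∼⟨ cross-≤+1-shift⇔ (num u) (num v) (den u) (den v) shift (shifted u) (shifted v)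
                          (shifted-correct u) (shifted-correct v) ⟩
    shifted u * den v ≤ shifted v * den u + den u * den v
      ≡⟨ cong₂ (λ a b → a ≤ b + X) (expand u (den v))
               (trans (expand v (den u)) (cong (λ c → whole v * c + part v * den u) (ℕ.*-comm (den v) (den u)))) ⟩
    whole u * X + part u * den v ≤ whole v * X + part v * den u + X
      ∼⟨ radix-≤⇔ (whole u) (whole v) (ℕ.*-monoˡ-< (den v) (part<den u))
                   (subst (part v * den u <_) (ℕ.*-comm (den v) (den u)) (ℕ.*-monoˡ-< (den u) (part<den v))) ⟩
    (whole u ≤ whole v ⊎ (whole u ≡ suc (whole v) × part u * den v ≤ part v * den u))
      ∼⟨ ≤⇔squash-≤ u v ⊎-⇔
         (≡suc⇔squash-≡suc u v ×-⇔ ⇔-trans (⇔-sym (frac-≤⇔ u v)) (≼⇔rank-≤ (frac u) v)) ⟩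
    (squash (whole u) ≤ squash (whole v) ⊎
     (squash (whole u) ≡ suc (squash (whole v)) × rank (frac u) ≤ rank (frac v)))
      ∼⟨ ⇔-sym (radix-≤⇔ (squash (whole u)) (squash (whole v)) (rank<T u) (rank<T v)) ⟩
    grid u ≤ grid v + T ∎
    where
    open EquationalReasoning
    X = den u * den v

-- Cube representations

VertexRel : ℕ → Set₁
VertexRel n = Fin n → Fin n → Set

UnitIntervalsMeet : ℚ → ℚ → Set
UnitIntervalsMeet p q = IntervalsMeet p (p ℚ.+ 1ℚ) q (q ℚ.+ 1ℚ)

UnitCubesMeet : ∀ {d} → (Fin d → ℚ) → (Fin d → ℚ) → Set
UnitCubesMeet a b = ∀ k → UnitIntervalsMeet (a k) (b k)

CubeRep : ∀ {n} → VertexRel n → ℕ → Set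
CubeRep {n} R d = Σ (Fin n → Fin d → ℚ) λ a → ∀ u v → u ≢ v → R u v ⇔ UnitCubesMeet (a u) (a v)

Near : ℕ → ℕ → ℕ → Set
Near T a b = a ≤ b + T × b ≤ a + T

GridRep : ∀ {n d} → VertexRel n → ℕ → (Fin n → Fin d → ℕ) → Set
GridRep R T y = ∀ u v → u ≢ v → R u v ⇔ (∀ k → Near T (y u k) (y v k))

gridRep⇒cubeRep : ∀ {n d} {R : VertexRel n} {t} {y : Fin n → Fin d → ℕ} → GridRep R (suc t) y → CubeRep R d
gridRep⇒cubeRep {t = t} {y} rep = (λ u k → gridPoint t (y u k)) , λ u v u≢v →
  ⇔-trans (rep u v u≢v) (∀-⇔ λ k → ⇔-sym (gridPoint-≤+1⇔ t _ _) ×-⇔ ⇔-sym (gridPoint-≤+1⇔ t _ _))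

gridBound : ℕ → ℕ
gridBound n = suc (n * 2) * suc n

cubeRep⇒gridRep : ∀ {n d} {R : VertexRel n} → CubeRep R d →
  ∃[ y ] (∀ u k → y u k < gridBound n) × GridRep R (suc n) y
cubeRep⇒gridRep (a , rep) =
  (λ u k → grid (column k) u) , (λ u k → grid<bound (column k) u) , λ u v u≢v →
  ⇔-trans (rep u v u≢v) (∀-⇔ λ k → ≤+1⇔grid-≤ (column k) u v ×-⇔ ≤+1⇔grid-≤ (column k) v u)
  where
  open GridNormalForm
  column : _ → _ → ℚ
  column k w = a w k

Searchable : Set → Set₁
Searchable A = ∀ {P : A → Set} → (∀ x → Dec (P x)) → Dec (∃ P)

searchable-Fin : ∀ K → Searchable (Fin K)
searchable-Fin K = any?

searchable-× : ∀ {A B} → Searchable A → Searchable B → Searchable (A × B)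
searchable-× search-A search-B P? =
  map′ (λ (a , b , p) → (a , b) , p) (λ ((a , b) , p) → a , b , p)
       (search-A λ a → search-B λ b → P? (a , b))

searchable-Vec : ∀ {A} → Searchable A → ∀ n → Searchable (Vec A n)
searchable-Vec search-A zero    P? = map′ ([] ,_) (λ { ([] , p) → p }) (P? [])
searchable-Vec search-A (suc n) P? =
  map′ (λ (a , as , p) → a ∷ as , p) (λ { (a ∷ as , p) → a , as , p })
       (search-A λ a → searchable-Vec search-A n λ as → P? (a ∷ as))

module _ {A} (search-A : Searchable A) {P : A → Set} (P? : ∀ x → Dec (P x)) where

  ¬∃¬⇒∀ : ¬ (∃ λ x → ¬ P x) → ∀ x → P x
  ¬∃¬⇒∀ ¬∃¬P x = decidable-stable (P? x) (λ ¬Px → ¬∃¬P (x , ¬Px))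

  ∀? : Dec (∀ x → P x)
  ∀? = map′ ¬∃¬⇒∀ (λ ∀P (x , ¬Px) → ¬Px (∀P x)) (¬? (search-A (¬? ∘ P?)))

  ¬∀⇒∃¬ : ¬ (∀ x → P x) → ∃ λ x → ¬ P x
  ¬∀⇒∃¬ ¬∀P = decidable-stable (search-A (¬? ∘ P?)) (¬∀P ∘ ¬∃¬⇒∀)

gridRep? : ∀ {n d} {R : VertexRel n} → (∀ u v → Dec (R u v)) →
           ∀ T (y : Fin n → Fin d → ℕ) → Dec (GridRep R T y)
gridRep? R? T y = all? λ u → all? λ v → ¬? (u ≟ᶠ v) →-dec
  (R? u v ⇔-dec all? λ k → (y u k ≤? y v k + T) ×-dec (y v k ≤? y u k + T))

gridRep-cong : ∀ {n d} {R : VertexRel n} {T} {y y' : Fin n → Fin d → ℕ} →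
               (∀ u k → y u k ≡ y' u k) → GridRep R T y → GridRep R T y'
gridRep-cong {T = T} y≗y' rep u v u≢v = ⇔-trans (rep u v u≢v) (∀-⇔ λ k →
  mk⇔ (subst₂ (Near T) (y≗y' u k) (y≗y' v k)) (subst₂ (Near T) (sym (y≗y' u k)) (sym (y≗y' v k))))

cubeRep? : ∀ {n} {R : VertexRel n} → (∀ u v → Dec (R u v)) → ∀ d → Dec (CubeRep R d)
cubeRep? {n} {R} R? d = map (mk⇔ (gridRep⇒cubeRep ∘ proj₂) toGrid)
  (searchable-Vec (searchable-Vec (searchable-Fin (gridBound n)) d) n λ Y → gridRep? R? (suc n) (entries Y))
  where
  entries : Vec (Vec (Fin (gridBound n)) d) n → Fin n → Fin d → ℕ
  entries Y u k = toℕ (lookup (lookup Y u) k)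
  toGrid : CubeRep R d → ∃ λ Y → GridRep R (suc n) (entries Y)
  toGrid cube with cubeRep⇒gridRep cube
  ... | y , y<bound , rep = Y , gridRep-cong y≗entries rep
    where
    Y = tabulate λ u → tabulate λ k → fromℕ< (y<bound u k)
    y≗entries : ∀ u k → y u k ≡ entries Y u k
    y≗entries u k = sym (trans (cong (λ ys → toℕ (lookup ys k)) (lookup∘tabulate _ u))
                               (trans (cong toℕ (lookup∘tabulate _ k)) (toℕ-fromℕ< (y<bound u k))))

cubeRep-resp : ∀ {n d} {R R' : VertexRel n} → (∀ u v → u ≢ v → R u v ⇔ R' u v) → CubeRep R d → CubeRep R' d
cubeRep-resp R⇔R' (a , rep) = a , λ u v u≢v → ⇔-trans (⇔-sym (R⇔R' u v u≢v)) (rep u v u≢v)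

cubeRep-pad : ∀ {n d} e {R : VertexRel n} → CubeRep R d → CubeRep R (d + e)
cubeRep-pad {n} {d} e (a , rep) = padded , λ u v u≢v → ⇔-trans (rep u v u≢v) (mk⇔ (to u v) (from u v))
  where
  origin : ℚ
  origin = gridPoint 0 0
  origin-meets : UnitIntervalsMeet origin origin
  origin-meets = Equivalence.from (gridPoint-≤+1⇔ 0 0 0) z≤n , Equivalence.from (gridPoint-≤+1⇔ 0 0 0) z≤n
  extend : (Fin d → ℚ) → Fin d ⊎ Fin e → ℚ
  extend x = [ x , const origin ]′
  padded : Fin n → Fin (d + e) → ℚ
  padded u = extend (a u) ∘ splitAt d
  to : ∀ u v → UnitCubesMeet (a u) (a v) → UnitCubesMeet (padded u) (padded v)
  to u v meet k with splitAt d k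
  ... | inj₁ j = meet j
  ... | inj₂ _ = origin-meets
  from : ∀ u v → UnitCubesMeet (padded u) (padded v) → UnitCubesMeet (a u) (a v)
  from u v meet j = subst (λ s → UnitIntervalsMeet (extend (a u) s) (extend (a v) s))
                          (splitAt-↑ˡ d j e) (meet (j ↑ˡ e))

cubeRep-mono : ∀ {n d d'} {R : VertexRel n} → d ≤ d' → CubeRep R d → CubeRep R d'
cubeRep-mono {d = d} {R = R} d≤d' = subst (CubeRep R) (ℕ.m+[n∸m]≡n d≤d') ∘ cubeRep-pad (_ ∸ d)

cubeRep-⋂ : ∀ {n c b} {R : VertexRel n} (Rs : Fin b → VertexRel n) →
            (∀ u v → u ≢ v → R u v ⇔ (∀ k → Rs k u v)) → (∀ k → CubeRep (Rs k) c) → CubeRep R (c * b)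
cubeRep-⋂ {n} {c} {b} Rs R⇔⋂Rs reps = stacked , λ u v u≢v →
  ⇔-trans (R⇔⋂Rs u v u≢v) (⇔-trans (∀-⇔ λ k → proj₂ (reps k) u v u≢v) (mk⇔ (to u v) (from u v)))
  where
  coords : Fin b → Fin n → Fin c → ℚ
  coords k = proj₁ (reps k)
  stacked : Fin n → Fin (c * b) → ℚ
  stacked u i = let (j , k) = remQuot b i in coords k u j
  to : ∀ u v → (∀ k → UnitCubesMeet (coords k u) (coords k v)) → UnitCubesMeet (stacked u) (stacked v)
  to u v meet i = let (j , k) = remQuot b i in meet k j
  from : ∀ u v → UnitCubesMeet (stacked u) (stacked v) → ∀ k → UnitCubesMeet (coords k u) (coords k v)
  from u v meet k j = subst (λ (j' , k') → UnitIntervalsMeet (coords k' u j') (coords k' v j'))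
                            (remQuot-combine j k) (meet (combine j k))

module _ {n} {R : VertexRel n} (R? : ∀ u v → Dec (R u v)) (R-sym : ∀ {u v} → R u v → R v u) where

  -- In coordinate w only w and its non-neighbours are more than 1 apart.
  position : Fin n → Fin n → ℕ
  position u w with u ≟ᶠ w | R? w u
  ... | yes _ | _     = 0
  ... | no _  | yes _ = 1
  ... | no _  | no _  = 2

  position-self : ∀ w → position w w ≡ 0
  position-self w with w ≟ᶠ w
  ... | yes _   = refl
  ... | no w≢w = ⊥-elim (w≢w refl)

  position-non-neighbour : ∀ {u w} → u ≢ w → ¬ R w u → position u w ≡ 2
  position-non-neighbour {u} {w} u≢w ¬Rwu with u ≟ᶠ w | R? w u
  ... | yes u≡w | _     = ⊥-elim (u≢w u≡w)
  ... | no _    | yes r = ⊥-elim (¬Rwu r)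
  ... | no _    | no _  = refl

  neighbours-near : ∀ {u v} → u ≢ v → R u v → ∀ w → Near 1 (position u w) (position v w)
  neighbours-near {u} {v} u≢v Ruv w with u ≟ᶠ w | R? w u | v ≟ᶠ w | R? w v
  ... | yes refl | _        | yes refl | _        = ⊥-elim (u≢v refl)
  ... | yes refl | _        | no _     | yes _    = z≤n , s≤s z≤n
  ... | yes refl | _        | no _     | no ¬Ruv  = ⊥-elim (¬Ruv Ruv)
  ... | no _     | yes _    | yes refl | _        = s≤s z≤n , z≤n
  ... | no _     | no ¬Rvu  | yes refl | _        = ⊥-elim (¬Rvu (R-sym Ruv))
  ... | no _     | yes _    | no _     | yes _    = s≤s z≤n , s≤s z≤n
  ... | no _     | yes _    | no _     | no _     = s≤s z≤n , s≤s (s≤s z≤n)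
  ... | no _     | no _     | no _     | yes _    = s≤s (s≤s z≤n) , s≤s z≤n
  ... | no _     | no _     | no _     | no _     = s≤s (s≤s z≤n) , s≤s (s≤s z≤n)

  cubeRep-byVertex : CubeRep R n
  cubeRep-byVertex = gridRep⇒cubeRep {t = 0} λ u v u≢v → mk⇔ (neighbours-near u≢v) (from u≢v)
    where
    from : ∀ {u v} → u ≢ v → (∀ w → Near 1 (position u w) (position v w)) → R u v
    from {u} {v} u≢v near = decidable-stable (R? u v) λ ¬Ruv →
      ℕ.<-irrefl refl (subst₂ _≤_ (position-non-neighbour (u≢v ∘ sym) ¬Ruv) (cong (_+ 1) (position-self u))
                                  (proj₂ (near u)))

-- Interval graphs

module _ {n} {R : VertexRel n} (R? : ∀ u v → Dec (R u v)) (R-sym : ∀ {u v} → R u v → R v u) where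

  graphOf : Graph n
  graphOf = record
    { adj     = λ u v → does (¬? (u ≟ᶠ v) ×-dec R? u v)
    ; adj-sym = λ u v → does-⇔ (mk⇔ flip flip) (¬? (u ≟ᶠ v) ×-dec R? u v) (¬? (v ≟ᶠ u) ×-dec R? v u)
    ; irrefl  = λ u → dec-false (¬? (u ≟ᶠ u) ×-dec R? u u) λ (u≢u , _) → u≢u refl
    }
    where
    flip : ∀ {u v} → u ≢ v × R u v → v ≢ u × R v u
    flip (u≢v , Ruv) = u≢v ∘ sym , R-sym Ruv

  adjacent-graphOf : ∀ {u v} → u ≢ v → Adjacent graphOf u v ⇔ R u v
  adjacent-graphOf {u} {v} u≢v =
    ⇔-trans (does≡true⇔ (¬? (u ≟ᶠ v) ×-dec R? u v)) (mk⇔ proj₂ (u≢v ,_))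

cubeRep-graphOf⇔ : ∀ {n d} {R : VertexRel n} (R? : ∀ u v → Dec (R u v)) (R-sym : ∀ {u v} → R u v → R v u) →
                   HasCubeRep (graphOf R? R-sym) d ⇔ CubeRep R d
cubeRep-graphOf⇔ {R = R} R? R-sym =
  mk⇔ (cubeRep-resp {R = Adjacent (graphOf R? R-sym)} λ _ _ → adjacent-graphOf R? R-sym)
      (cubeRep-resp {R = R} λ _ _ → ⇔-sym ∘ adjacent-graphOf R? R-sym)

complete⇒cubeRep₀ : ∀ {n} {G : Graph n} → IsComplete G → HasCubeRep G 0
complete⇒cubeRep₀ complete = (λ _ ()) , λ u v u≢v → mk⇔ (λ _ ()) (λ _ → complete u v u≢v)

¬cubeRep⇒¬complete : ∀ {n c} {G : Graph n} → ¬ HasCubeRep G c → ¬ IsComplete G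
¬cubeRep⇒¬complete {G = G} ¬rep = ¬rep ∘ cubeRep-mono {R = Adjacent G} z≤n ∘ complete⇒cubeRep₀ {G = G}

isCubicity-suc : ∀ {n c} {G : Graph n} → HasCubeRep G (suc c) → ¬ HasCubeRep G c → IsCubicity G (suc c)
isCubicity-suc {c = c} {G} rep ¬rep = inj₂ (¬cubeRep⇒¬complete {G = G} ¬rep , s≤s z≤n , rep , minimal)
  where
  minimal : ∀ c' → 1 ≤ c' → HasCubeRep G c' → suc c ≤ c'
  minimal c' _ rep' with suc c ≤? c'
  ... | yes 1+c≤c' = 1+c≤c'
  ... | no  1+c≰c' = ⊥-elim (¬rep (cubeRep-mono {R = Adjacent G} (ℕ.s≤s⁻¹ (ℕ.≰⇒> 1+c≰c')) rep'))

interval⇒isBoxicity₁ : ∀ {n} {G : Graph n} → ¬ IsComplete G → IsIntervalGraph G → IsBoxicity G 1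
interval⇒isBoxicity₁ ¬complete (lo , hi , lo≤hi , rep) =
  inj₂ (¬complete , ℕ.≤-refl , boxes , λ _ 1≤b' _ → 1≤b')
  where
  boxes = (λ u _ → lo u) , (λ u _ → hi u) , (λ u _ → lo≤hi u) ,
          λ u v u≢v → ⇔-trans (rep u v u≢v) (mk⇔ const (λ meet → meet 0F))

-- Endpoints in [0, 2n] suffice: any endpoints can be replaced by their ranks among all 2n of them.
IntervalSystem : ℕ → Set
IntervalSystem n = Vec (Fin (suc (n + n)) × Fin (suc (n + n))) n

module IntervalSystem {n} (g : IntervalSystem n) where

  left right : Fin n → ℕ
  left  u = toℕ (proj₁ (lookup g u))
  right u = toℕ (proj₂ (lookup g u))

  WellFormed : Set
  WellFormed = ∀ u → left u ≤ right u

  wellFormed? : Dec WellFormed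
  wellFormed? = all? λ u → left u ≤? right u

  Meets : VertexRel n
  Meets u v = left u ≤ right v × left v ≤ right u

  meets? : ∀ u v → Dec (Meets u v)
  meets? u v = (left u ≤? right v) ×-dec (left v ≤? right u)

  meets-sym : ∀ {u v} → Meets u v → Meets v u
  meets-sym = swap

  graph : Graph n
  graph = graphOf meets? meets-sym

open IntervalSystem using (WellFormed; Meets; wellFormed?; meets?; meets-sym; left; right; graph)

searchable-IntervalSystem : ∀ n → Searchable (IntervalSystem n)
searchable-IntervalSystem n = searchable-Vec (searchable-× (searchable-Fin _) (searchable-Fin _)) n

intervalRep⇒system : ∀ {n} (lo hi : Fin n → ℚ) → (∀ u → lo u ℚ.≤ hi u) →
  ∃[ g ] WellFormed g × (∀ u v → IntervalsMeet (lo u) (hi u) (lo v) (hi v) ⇔ Meets g u v)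
intervalRep⇒system {n} lo hi lo≤hi =
  g , (λ u → Equivalence.to (lo≤hi⇔ u u) (lo≤hi u)) , λ u v → lo≤hi⇔ u v ×-⇔ lo≤hi⇔ v u
  where
  endpoints : Fin (n + n) → ℚ
  endpoints = [ lo , hi ]′ ∘ splitAt n
  open Rank ℚ._≤?_ ℚ.≤-trans ℚ.≤-total endpoints
  g : IntervalSystem n
  g = tabulate λ u → fromℕ< (s≤s (rank≤N (lo u))) , fromℕ< (s≤s (rank≤N (hi u)))
  left≡ : ∀ u → left g u ≡ rank (lo u)
  left≡ u = trans (cong (toℕ ∘ proj₁) (lookup∘tabulate _ u)) (toℕ-fromℕ< _)
  right≡ : ∀ u → right g u ≡ rank (hi u)
  right≡ u = trans (cong (toℕ ∘ proj₂) (lookup∘tabulate _ u)) (toℕ-fromℕ< _)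
  lo≤hi⇔ : ∀ u v → lo u ℚ.≤ hi v ⇔ left g u ≤ right g v
  lo≤hi⇔ u v = begin
    lo u ℚ.≤ hi v                            ≡⟨ cong (lo u ℚ.≤_) (endpoint-hi v) ⟨
    lo u ℚ.≤ endpoints (n ↑ʳ v)              ∼⟨ ≼⇔rank-≤ (lo u) (n ↑ʳ v) ⟩
    rank (lo u) ≤ rank (endpoints (n ↑ʳ v))
      ≡⟨ cong₂ _≤_ (sym (left≡ u)) (trans (cong rank (endpoint-hi v)) (sym (right≡ v))) ⟩
    left g u ≤ right g v ∎
    where
    open EquationalReasoning
    endpoint-hi : ∀ v → endpoints (n ↑ʳ v) ≡ hi v
    endpoint-hi v = cong [ lo , hi ]′ (splitAt-↑ʳ n n v)

wellFormed⇒isInterval : ∀ {n} (g : IntervalSystem n) → WellFormed g → IsIntervalGraph (graph g)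
wellFormed⇒isInterval g wf =
  lo , hi , (λ u → Equivalence.from (gridPoint-≤⇔ 0 _ _) (wf u)) , λ u v u≢v →
  ⇔-trans (adjacent-graphOf (meets? g) (meets-sym g) u≢v)
          (⇔-sym (gridPoint-≤⇔ 0 _ _) ×-⇔ ⇔-sym (gridPoint-≤⇔ 0 _ _))
  where
  lo hi : Fin _ → ℚ
  lo u = gridPoint 0 (left g u)
  hi u = gridPoint 0 (right g u)

IntervalGraphsHaveCubeRep : ℕ → ℕ → Set
IntervalGraphsHaveCubeRep n d = ∀ (g : IntervalSystem n) → WellFormed g → CubeRep (Meets g) d

intervalGraphsHaveCubeRep? : ∀ n d → Dec (IntervalGraphsHaveCubeRep n d)
intervalGraphsHaveCubeRep? n d =
  ∀? (searchable-IntervalSystem n) λ g → wellFormed? g →-dec cubeRep? (meets? g) d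

intervalGraphsHaveCubeRep-n : ∀ n → IntervalGraphsHaveCubeRep n n
intervalGraphsHaveCubeRep-n n g _ = cubeRep-byVertex (meets? g) (meets-sym g)

¬intervalGraphsHaveCubeRep-0 : ∀ {n} → 2 ≤ n → ¬ IntervalGraphsHaveCubeRep n 0
¬intervalGraphsHaveCubeRep-0 {suc (suc m)} (s≤s (s≤s z≤n)) all =
  ℕ.1+n≰n (proj₂ (Equivalence.from (proj₂ (all split split-wellFormed) 0F (sucF 0F) (λ ())) (λ ())))
  where
  point : Fin (suc (suc m)) → Fin _
  point 0F       = 0F
  point (sucF _) = sucF 0F
  split : IntervalSystem (suc (suc m))
  split = tabulate λ u → point u , point u
  split-wellFormed : WellFormed split
  split-wellFormed u =
    subst (λ (a , b) → toℕ a ≤ toℕ b) (sym (lookup∘tabulate (λ v → point v , point v) u)) ℕ.≤-refl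

boxRep⇒cubeRep : ∀ {n b c} {G : Graph n} → IntervalGraphsHaveCubeRep n c → HasBoxRep G b → HasCubeRep G (c * b)
boxRep⇒cubeRep {n} {b} {c} {G} all (lo , hi , lo≤hi , rep) = cubeRep-⋂ Coordinate rep coordinateCubeRep
  where
  Coordinate : Fin b → VertexRel n
  Coordinate k u v = IntervalsMeet (lo u k) (hi u k) (lo v k) (hi v k)
  coordinateCubeRep : ∀ k → CubeRep (Coordinate k) c
  coordinateCubeRep k with intervalRep⇒system (λ u → lo u k) (λ u → hi u k) (λ u → lo≤hi u k)
  ... | g , wf , Coordinate⇔Meets = cubeRep-resp (λ u v _ → ⇔-sym (Coordinate⇔Meets u v)) (all g wf)

cubicity≤c*boxicity : ∀ {n c} → 1 ≤ c → IntervalGraphsHaveCubeRep n c →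
  ∀ (G : Graph n) b c' → ¬ IsComplete G → IsBoxicity G b → IsCubicity G c' → c' ≤ c * b
cubicity≤c*boxicity _   _   G b c' ¬complete (inj₁ (complete , _)) _ = ⊥-elim (¬complete complete)
cubicity≤c*boxicity _   _   G b c' ¬complete _ (inj₁ (complete , _)) = ⊥-elim (¬complete complete)
cubicity≤c*boxicity {c = c} 1≤c all G b c' _ (inj₂ (_ , 1≤b , box , _)) (inj₂ (_ , _ , _ , minimal)) =
  minimal (c * b) (ℕ.*-mono-≤ 1≤c 1≤b) (boxRep⇒cubeRep {G = G} all box)

-- The extremal interval graph

threshold : ∀ {p} {P : ℕ → Set p} → (∀ d → Dec (P d)) → ¬ P 0 →
            ∀ {d} → P d → ∃[ c ] (¬ P c × P (suc c))
threshold P? ¬P0 {zero}  P0  = ⊥-elim (¬P0 P0)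
threshold P? ¬P0 {suc d} P1+d with P? d
... | yes Pd  = threshold P? ¬P0 Pd
... | no  ¬Pd = d , ¬Pd , P1+d

extremalIntervalGraph : ∀ {n c} → IntervalGraphsHaveCubeRep n (suc c) → ¬ IntervalGraphsHaveCubeRep n c →
  Σ (Graph n) λ G → IsIntervalGraph G × ¬ IsComplete G × IsCubicity G (suc c)
extremalIntervalGraph {n} {c} all ¬all =
  graph g , wellFormed⇒isInterval g wf , ¬cubeRep⇒¬complete {G = graph g} ¬cubeRep ,
  isCubicity-suc {G = graph g} (Equivalence.from (cubeRep-graphOf⇔ (meets? g) (meets-sym g)) (all g wf)) ¬cubeRep
  where
  counterexample = ¬∀⇒∃¬ (searchable-IntervalSystem n) (λ g → wellFormed? g →-dec cubeRep? (meets? g) c) ¬all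
  g = proj₁ counterexample
  wf : WellFormed g
  wf = decidable-stable (wellFormed? g) λ ¬wf → proj₂ counterexample (⊥-elim ∘ ¬wf)
  ¬cubeRep : ¬ HasCubeRep (graph g) c
  ¬cubeRep rep = proj₂ counterexample (const (Equivalence.to (cubeRep-graphOf⇔ (meets? g) (meets-sym g)) rep))

lemma4 : ∀ (n : ℕ) → 2 ≤ n →
    Σ (Graph n) λ G' → ∃[ c ] (IsIntervalGraph G' × IsCubicity G' c × IsMaxCubBoxRatio n c)
lemma4 n 2≤n =
  let c , ¬all-c , all-1+c = threshold (intervalGraphsHaveCubeRep? n) (¬intervalGraphsHaveCubeRep-0 2≤n)
                                       (intervalGraphsHaveCubeRep-n n)
      G , interval , ¬complete , cubicity = extremalIntervalGraph all-1+c ¬all-c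
  in  G , suc c , interval , cubicity ,
      cubicity≤c*boxicity (s≤s z≤n) all-1+c ,
      G , 1 , suc c , ¬complete , interval⇒isBoxicity₁ {G = G} ¬complete interval , cubicity ,
      sym (ℕ.*-identityʳ (suc c))
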